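{- Let $n\ge 3$ and let $\mathbf{G}=\{G_1,\dots,G_{2n-1}\}$ be a collection of $2n-1$ bipartite graphs on the same bipartition $V=(X,Y)$ with $X=\{u_1,u_3,\dots,u_{2n-3},x\}$ and $Y=\{u_2,u_4,\dots,u_{2n-2},y\}$ ($|X|=|Y|=n$), such that $C=u_1u_2\dots u_{2n-2}u_1$ satisfies $u_iu_{i+1}\in E(G_i)$ for every $i\in[2n-2]$ (indices of the $u$'s modulo $2n-2$, so $u_{2n-2}u_1\in E(G_{2n-2})$). Let $D$ be the digraph on $V$ whose arc set is $$A=\bigcup_{u_i\in X\setminus\{x\}}\{\overrightarrow{u_iu}: u\in V,\ u_iu\in E(G_i),\ u\neq u_{i+1}\}.$$ If there exists $k\in\{2,4,\dots,2n-2\}$ such that $d^-_D(u_k)+|N_{G_k}(x)\cap V(C)|\geq n-1$ and $u_{k+1}y\in E(G_{2n-1})$, then there exist a Hamiltonian path $P$ (with $V(P)=V$) with endpoints $x$ and $y$ and an injection $\phi:E(P)\to[2n-1]$ with $e\in E(G_{\phi(e)})$ for every $e\in E(P)$.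
   Context: $[a]=\{1,\dots,a\}$; $N_G(v)$ is the neighbourhood of $v$ in $G$; $d^-_D(u)$ is the number of in-neighbours of $u$ in the digraph $D$; $V(C)=\{u_1,\dots,u_{2n-2}\}$. -}

module Defs where

open import Data.Nat using (ℕ; zero; suc; _+_; _*_; _∸_; _≤_; _<_; _≡ᵇ_)
open import Data.Nat.Properties using (suc-injective)
import Data.Nat as ℕ
open import Data.Fin using (Fin; toℕ; lower₁; fromℕ)
import Data.Fin as F
open import Data.Bool using (Bool; true; false; _∧_; not)
open import Data.List using (List; _∷_; []; _++_; map; length; filterᵇ)
open import Data.Fin.Base using () renaming (zero to fz; suc to fs)
open import Relation.Nullary using (yes; no)
open import Relation.Binary.PropositionalEquality using (_≡_; sym)
open import Data.List using () renaming (allFin to allFinL)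

L : ℕ → ℕ
L n = 2 * n ∸ 2

-- Vertex set V = {u_1,…,u_{2n-2}, x, y}.
-- (u i) with i : Fin (2n-2) is the vertex u_{toℕ i + 1} of the paper.
data Vtx (n : ℕ) : Set where
  u : Fin (L n) → Vtx n
  x : Vtx n
  y : Vtx n

vertices : (n : ℕ) → List (Vtx n)
vertices n = map u (allFinL (L n)) ++ x ∷ y ∷ []

countV : ∀ {n} → (Vtx n → Bool) → ℕ
countV {n} P = length (filterᵇ P (vertices n))

evenᵇ : ℕ → Bool
evenᵇ zero = true
evenᵇ (suc m) = not (evenᵇ m)

inX : ∀ {n} → Vtx n → Bool
inX (u i) = evenᵇ (toℕ i)
inX x = true
inX y = false

inC : ∀ {n} → Vtx n → Bool
inC (u _) = true
inC x = false
inC y = false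

_==_ : ∀ {n} → Vtx n → Vtx n → Bool
u i == u j = toℕ i ≡ᵇ toℕ j
x == x = true
y == y = true
_ == _ = false

csuc : ∀ {k} → Fin k → Fin k
csuc {suc k} i with toℕ i ℕ.≟ k
... | yes _ = fz
... | no ne = lower₁ (fs i) (λ eq → ne (sym (suc-injective eq)))

Graph : ℕ → Set
Graph n = Vtx n → Vtx n → Bool

IsBipartiteGraph : ∀ {n} → Graph n → Set
IsBipartiteGraph G =
  (∀ a b → G a b ≡ G b a) × (∀ a b → G a b ≡ true → ¬ (inX a ≡ inX b))
  where
  open import Data.Product using (_×_)
  open import Relation.Nullary using (¬_)

-- The digraph D: arc u_i → v  iff  u_i ∈ X∖{x}, u_i v ∈ E(G_i), v ≠ u_{i+1}.
-- Graphs are indexed by ℕ: G j is G_j (only 1 ≤ j ≤ 2n-1 is meaningful).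
arcD : ∀ {n} → (ℕ → Graph n) → Vtx n → Vtx n → Bool
arcD G (u i) v = evenᵇ (toℕ i) ∧ G (suc (toℕ i)) (u i) v ∧ not (v == u (csuc i))
arcD G x v = false
arcD G y v = false

indegD : ∀ {n} → (ℕ → Graph n) → Vtx n → ℕ
indegD G v = countV (λ a → arcD G a v)

nbrsInC : ∀ {n} → Graph n → Vtx n → ℕ
nbrsInC G w = countV (λ v → G w v ∧ inC v)

{-# OPTIONS --safe #-}
module Submission where

-- Indices of the u's are taken mod 2n-2.  If x u_k ∈ E(G_k), the path x u_k u_{k-1} … u_{k+1} y
-- is transversal: each cycle edge u_j u_{j+1} on it keeps its own graph G_j, G_k pays for the
-- edge at x and G_{2n-1} for the edge u_{k+1} y.  If some arc u_i → u_k of D has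
-- x u_{i+1} ∈ E(G_k), then x u_{i+1} … u_k u_i u_{i-1} … u_{k+1} y works likewise, G_i paying
-- for the jump u_k u_i.  If neither happens, the vertices u_{i+1} for the in-neighbours u_i of
-- u_k, the G_k-neighbours of x on C, and u_k itself form pairwise disjoint sets of cycle
-- vertices in Y, of which there are only n - 1: this contradicts the degree hypothesis.

open import Defs
open import Data.Bool using (Bool; true; false; _∧_; not; if_then_else_)
import Data.Bool as Bool
open import Data.Bool.Properties
  using ( not-involutive; not-injective; ¬-not; ∧-identityʳ; ∧-zeroʳ; ∧-conicalˡ; ∧-conicalʳ
        ; T-≡)
open import Data.Fin using (Fin; toℕ; inject₁; fromℕ) renaming (zero to fzero; suc to fsuc)
open import Data.Fin.Properties
  using (any?; toℕ-injective; toℕ<n; toℕ-lower₁; toℕ-inject₁; toℕ-fromℕ; toℕ-fromℕ<)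
open import Data.List using (_∷_; []; _++_; map; length; filterᵇ; tabulate)
open import Data.List.Properties using (filter-++; length-++; map-tabulate)
open import Data.Nat using (ℕ; zero; suc; _+_; _*_; _∸_; _≤_; _<_; _%_; z≤n; s≤s; NonZero)
open import Data.Nat.DivMod
  using (_mod_; %-distribˡ-+; m%n%n≡m%n; [m+kn]%n≡m%n; [m+n]%n≡m%n; m<n⇒m%n≡m; n%n≡0; m%n<n)
open import Data.Nat.Properties
open import Data.Nat.Tactic.RingSolver using (solve-∀)
open import Algebra.Properties.CommutativeMonoid.Sum +-0-commutativeMonoid
  using (sum; sum-syntax; ∑-distrib-+; sum-cong-≗; sum-init-last; sum-remove)
open import Data.Product using (Σ; ∃; ∄-syntax; _×_; _,_; proj₁; proj₂)
open import Data.Sum using (inj₁; inj₂)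
open import Function using (_∘_; id)
open import Function.Bundles using (Equivalence)
open import Relation.Binary using (tri<; tri≈; tri>)
open import Relation.Binary.PropositionalEquality
open import Relation.Nullary using (yes; no; does; contradiction)
open import Relation.Nullary.Decidable using (dec-true; dec-false; T?)

⟦_⟧ : Bool → ℕ
⟦ true ⟧ = 1
⟦ false ⟧ = 0

⟦⟧-exclusive-≤ : ∀ a b e o →
  (a ≡ true → b ≡ false × e ≡ false × o ≡ true) →
  (b ≡ true → e ≡ false × o ≡ true) →
  (e ≡ true → o ≡ true) →
  ⟦ a ⟧ + ⟦ b ⟧ + ⟦ e ⟧ ≤ ⟦ o ⟧
⟦⟧-exclusive-≤ true b e o a⇒ _ _ with a⇒ refl
... | refl , refl , refl = ≤-refl
⟦⟧-exclusive-≤ false true e o _ b⇒ _ with b⇒ refl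
... | refl , refl = ≤-refl
⟦⟧-exclusive-≤ false false true o _ _ e⇒ with e⇒ refl
... | refl = ≤-refl
⟦⟧-exclusive-≤ false false false o _ _ _ = z≤n

∑-mono-≤ : ∀ {r} {f g : Fin r → ℕ} → (∀ i → f i ≤ g i) → sum f ≤ sum g
∑-mono-≤ {zero} f≤g = z≤n
∑-mono-≤ {suc r} f≤g = +-mono-≤ (f≤g fzero) (∑-mono-≤ (f≤g ∘ fsuc))

term≤∑ : ∀ {r} (f : Fin (suc r) → ℕ) i → f i ≤ sum f
term≤∑ f i = ≤-trans (m≤m+n (f i) _) (≤-reflexive (sym (sum-remove {i = i} f)))

∑-odd : ∀ {r q} → r ≡ q + q → ∑[ j < r ] ⟦ not (evenᵇ (toℕ j)) ⟧ ≡ q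
∑-odd {zero} {zero} _ = refl
∑-odd {suc zero} {suc q} r≡q+q = contradiction (trans (suc-injective r≡q+q) (+-suc q q)) 0≢1+n
∑-odd {suc (suc r)} {suc q} r≡q+q =
  cong suc (trans (sum-cong-≗ {r} (λ j → cong ⟦_⟧ (not-involutive (not (evenᵇ (toℕ j))))))
                  (∑-odd (suc-injective (trans (suc-injective r≡q+q) (+-suc q q)))))

evenᵇ-double : ∀ q → evenᵇ (q + q) ≡ true
evenᵇ-double zero = refl
evenᵇ-double (suc q) rewrite +-suc q q | not-involutive (evenᵇ (q + q)) = evenᵇ-double q

length-filterᵇ-tabulate : ∀ {A : Set} {r} (P : A → Bool) (f : Fin r → A) →
  length (filterᵇ P (tabulate f)) ≡ ∑[ i < r ] ⟦ P (f i) ⟧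
length-filterᵇ-tabulate {r = zero} P f = refl
length-filterᵇ-tabulate {r = suc r} P f with P (f fzero)
... | true = cong suc (length-filterᵇ-tabulate P (f ∘ fsuc))
... | false = length-filterᵇ-tabulate P (f ∘ fsuc)

countV-∑ : ∀ {n} (P : Vtx n → Bool) → P x ≡ false → P y ≡ false →
  countV P ≡ ∑[ i < L n ] ⟦ P (u i) ⟧
countV-∑ {n} P Px Py = begin
  length (filterᵇ P (map u (tabulate id) ++ x ∷ y ∷ []))
    ≡⟨ cong length (filter-++ (T? ∘ P) (map u (tabulate id)) _) ⟩
  length (filterᵇ P (map u (tabulate id)) ++ filterᵇ P (x ∷ y ∷ []))
    ≡⟨ length-++ (filterᵇ P (map u (tabulate id))) ⟩
  length (filterᵇ P (map u (tabulate id))) + length (filterᵇ P (x ∷ y ∷ []))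
    ≡⟨ cong₂ _+_ (cong (length ∘ filterᵇ P) (map-tabulate id u)) (cong length x,y-rejected) ⟩
  length (filterᵇ P (tabulate u)) + 0
    ≡⟨ +-identityʳ _ ⟩
  length (filterᵇ P (tabulate u))
    ≡⟨ length-filterᵇ-tabulate P u ⟩
  ∑[ i < L n ] ⟦ P (u i) ⟧ ∎
  where
  open ≡-Reasoning
  x,y-rejected : filterᵇ P (x ∷ y ∷ []) ≡ []
  x,y-rejected rewrite Px | Py = refl

toℕ-csuc : ∀ {r} (i : Fin (suc r)) → toℕ (csuc i) ≡ suc (toℕ i) % suc r
toℕ-csuc {r} i with toℕ i ≟ r
... | yes i≡r rewrite i≡r = sym (n%n≡0 (suc r))
... | no i≢r = trans (toℕ-lower₁ (fsuc i) (i≢r ∘ sym ∘ suc-injective))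
                     (sym (m<n⇒m%n≡m (s≤s (≤∧≢⇒< (≤-pred (toℕ<n i)) i≢r))))

csuc-inject₁ : ∀ {r} (j : Fin r) → csuc (inject₁ j) ≡ fsuc j
csuc-inject₁ {r} j = toℕ-injective {i = csuc (inject₁ j)} {j = fsuc j} (begin
  toℕ (csuc (inject₁ j))        ≡⟨ toℕ-csuc (inject₁ j) ⟩
  suc (toℕ (inject₁ j)) % suc r ≡⟨ cong (λ t → suc t % suc r) (toℕ-inject₁ j) ⟩
  suc (toℕ j) % suc r           ≡⟨ m<n⇒m%n≡m (s≤s (toℕ<n j)) ⟩
  suc (toℕ j) ∎)
  where open ≡-Reasoning

csuc-fromℕ : ∀ r → csuc (fromℕ r) ≡ fzero
csuc-fromℕ r = toℕ-injective (begin
  toℕ (csuc (fromℕ r))        ≡⟨ toℕ-csuc (fromℕ r) ⟩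
  suc (toℕ (fromℕ r)) % suc r ≡⟨ cong (λ t → suc t % suc r) (toℕ-fromℕ r) ⟩
  suc r % suc r               ≡⟨ n%n≡0 (suc r) ⟩
  0 ∎)
  where open ≡-Reasoning

∑-csuc : ∀ {r} (f : Fin (suc r) → ℕ) → ∑[ i < suc r ] f (csuc i) ≡ sum f
∑-csuc {r} f = begin
  ∑[ i < suc r ] f (csuc i)
    ≡⟨ sum-init-last (f ∘ csuc) ⟩
  ∑[ j < r ] f (csuc (inject₁ j)) + f (csuc (fromℕ r))
    ≡⟨ cong₂ _+_ (sum-cong-≗ (cong f ∘ csuc-inject₁)) (cong f (csuc-fromℕ r)) ⟩
  ∑[ j < r ] f (fsuc j) + f fzero
    ≡⟨ +-comm _ (f fzero) ⟩
  sum f ∎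
  where open ≡-Reasoning

evenᵇ-csuc : ∀ {r} → evenᵇ (suc r) ≡ true → (i : Fin (suc r)) →
  evenᵇ (toℕ (csuc i)) ≡ not (evenᵇ (toℕ i))
evenᵇ-csuc {r} even i with toℕ i ≟ r
... | yes i≡r rewrite i≡r = sym even
... | no i≢r = cong evenᵇ (toℕ-lower₁ (fsuc i) (i≢r ∘ sym ∘ suc-injective))

[m+n%d]%d≡[m+n]%d : ∀ a b d .{{_ : NonZero d}} → (a + b % d) % d ≡ (a + b) % d
[m+n%d]%d≡[m+n]%d a b d = begin
  (a + b % d) % d         ≡⟨ %-distribˡ-+ a (b % d) d ⟩
  (a % d + b % d % d) % d ≡⟨ cong (λ t → (a % d + t) % d) (m%n%n≡m%n b d) ⟩
  (a % d + b % d) % d     ≡⟨ %-distribˡ-+ a b d ⟨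
  (a + b) % d ∎
  where open ≡-Reasoning

module RotationAfter {r : ℕ} (k : Fin (suc r)) where

  private
    b : ℕ
    b = suc (toℕ k)

    shift-identity₁ : ∀ b j r → b * r + (b + j) ≡ j + b * suc r
    shift-identity₁ = solve-∀

    shift-identity₂ : ∀ b j r → b + (b * r + j) ≡ j + b * suc r
    shift-identity₂ = solve-∀

  rotate : ℕ → Fin (suc r)
  rotate j = (b + j) mod suc r

  unrotate : ℕ → ℕ
  unrotate i = (b * r + i) % suc r

  toℕ-rotate : ∀ j → toℕ (rotate j) ≡ (b + j) % suc r
  toℕ-rotate j = toℕ-fromℕ< (m%n<n (b + j) (suc r))

  unrotate< : ∀ i → unrotate i < suc r
  unrotate< i = m%n<n (b * r + i) (suc r)

  unrotate-rotate : ∀ {j} → j < suc r → unrotate (toℕ (rotate j)) ≡ j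
  unrotate-rotate {j} j<1+r = begin
    (b * r + toℕ (rotate j)) % suc r    ≡⟨ cong (λ t → (b * r + t) % suc r) (toℕ-rotate j) ⟩
    (b * r + (b + j) % suc r) % suc r   ≡⟨ [m+n%d]%d≡[m+n]%d (b * r) (b + j) (suc r) ⟩
    (b * r + (b + j)) % suc r           ≡⟨ cong (_% suc r) (shift-identity₁ b j r) ⟩
    (j + b * suc r) % suc r             ≡⟨ [m+kn]%n≡m%n j b (suc r) ⟩
    j % suc r                           ≡⟨ m<n⇒m%n≡m j<1+r ⟩
    j ∎
    where open ≡-Reasoning

  rotate-unrotate : ∀ (i : Fin (suc r)) → rotate (unrotate (toℕ i)) ≡ i
  rotate-unrotate i = toℕ-injective (begin
    toℕ (rotate (unrotate (toℕ i)))        ≡⟨ toℕ-rotate _ ⟩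
    (b + (b * r + toℕ i) % suc r) % suc r  ≡⟨ [m+n%d]%d≡[m+n]%d b (b * r + toℕ i) (suc r) ⟩
    (b + (b * r + toℕ i)) % suc r          ≡⟨ cong (_% suc r) (shift-identity₂ b (toℕ i) r) ⟩
    (toℕ i + b * suc r) % suc r            ≡⟨ [m+kn]%n≡m%n (toℕ i) b (suc r) ⟩
    toℕ i % suc r                          ≡⟨ m<n⇒m%n≡m (toℕ<n i) ⟩
    toℕ i ∎)
    where open ≡-Reasoning

  csuc-rotate : ∀ j → csuc (rotate j) ≡ rotate (suc j)
  csuc-rotate j = toℕ-injective (begin
    toℕ (csuc (rotate j))          ≡⟨ toℕ-csuc (rotate j) ⟩
    suc (toℕ (rotate j)) % suc r   ≡⟨ cong (λ t → suc t % suc r) (toℕ-rotate j) ⟩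
    (1 + (b + j) % suc r) % suc r  ≡⟨ [m+n%d]%d≡[m+n]%d 1 (b + j) (suc r) ⟩
    suc (b + j) % suc r            ≡⟨ cong (_% suc r) (+-suc b j) ⟨
    (b + suc j) % suc r            ≡⟨ toℕ-rotate (suc j) ⟨
    toℕ (rotate (suc j)) ∎)
    where open ≡-Reasoning

  rotate-zero : rotate 0 ≡ csuc k
  rotate-zero = toℕ-injective (trans (toℕ-rotate 0)
                                     (trans (cong (_% suc r) (+-identityʳ b)) (sym (toℕ-csuc k))))

  rotate-last : rotate r ≡ k
  rotate-last = toℕ-injective (begin
    toℕ (rotate r)        ≡⟨ toℕ-rotate r ⟩
    suc (toℕ k + r) % suc r ≡⟨ cong (_% suc r) (+-suc (toℕ k) r) ⟨
    (toℕ k + suc r) % suc r ≡⟨ [m+n]%n≡m%n (toℕ k) (suc r) ⟩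
    toℕ k % suc r         ≡⟨ m<n⇒m%n≡m (toℕ<n k) ⟩
    toℕ k ∎)
    where open ≡-Reasoning

u-==-refl : ∀ {n} (i : Fin (L n)) → (u {n} i == u i) ≡ true
u-==-refl i = Equivalence.to T-≡ (≡⇒≡ᵇ (toℕ i) (toℕ i) refl)

u-==⇒≡ : ∀ {n} {i j : Fin (L n)} → (u {n} i == u j) ≡ true → i ≡ j
u-==⇒≡ {i = i} {j} eq = toℕ-injective (≡ᵇ⇒≡ (toℕ i) (toℕ j) (Equivalence.from T-≡ eq))

module _ {n} (G : ℕ → Graph n) (i : Fin (L n)) {v : Vtx n} (arc : arcD G (u i) v ≡ true) where

  arcD-even : evenᵇ (toℕ i) ≡ true
  arcD-even = ∧-conicalˡ _ _ arc

  arcD-edge : G (suc (toℕ i)) (u i) v ≡ true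
  arcD-edge = ∧-conicalˡ _ _ (∧-conicalʳ (evenᵇ (toℕ i)) _ arc)

  arcD-skips-next : (v == u (csuc i)) ≡ false
  arcD-skips-next = not-injective (∧-conicalʳ _ _ (∧-conicalʳ (evenᵇ (toℕ i)) _ arc))

InjectiveBelow : ∀ {A : Set} → ℕ → (ℕ → A) → Set
InjectiveBelow N f = ∀ s t → s < N → t < N → f s ≡ f t → s ≡ t

retraction⇒injectiveBelow : ∀ {A : Set} {N} {f : ℕ → A} (g : A → ℕ) →
  (∀ t → t < N → g (f t) ≡ t) → InjectiveBelow N f
retraction⇒injectiveBelow g g∘f s t s<N t<N fs≡ft =
  trans (sym (g∘f s s<N)) (trans (cong g fs≡ft) (g∘f t t<N))

TransversalHamiltonPath : (n : ℕ) → (ℕ → Graph n) → Set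
TransversalHamiltonPath n G = Σ (ℕ → Vtx n) λ p → Σ (ℕ → ℕ) λ φ →
    (p 0 ≡ x)
  × (p (2 * n ∸ 1) ≡ y)
  × InjectiveBelow (2 * n) p
  × (∀ v → ∃ λ t → t < 2 * n × p t ≡ v)
  × InjectiveBelow (2 * n ∸ 1) φ
  × (∀ t → t < 2 * n ∸ 1 → 1 ≤ φ t × φ t ≤ 2 * n ∸ 1)
  × (∀ t → t < 2 * n ∸ 1 → G (φ t) (p t) (p (suc t)) ≡ true)

module _ (n₀ : ℕ) where

  private
    n m M : ℕ
    n = 3 + n₀
    m = L n
    M = m ∸ 1

  m≡[n∸1]+[n∸1] : m ≡ (n ∸ 1) + (n ∸ 1)
  m≡[n∸1]+[n∸1] =
    cong suc (trans (+-suc n₀ _) (cong (λ t → suc (n₀ + suc (suc t))) (+-identityʳ n₀)))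

  m-even : evenᵇ m ≡ true
  m-even = trans (cong evenᵇ m≡[n∸1]+[n∸1]) (evenᵇ-double (n ∸ 1))

  cycleColourBipartite : {G : ℕ → Graph n} →
    (∀ j → 1 ≤ j → j ≤ 2 * n ∸ 1 → IsBipartiteGraph (G j)) →
    (i : Fin m) → IsBipartiteGraph (G (suc (toℕ i)))
  cycleColourBipartite bipartite i = bipartite (suc (toℕ i)) (s≤s z≤n) (s≤s (<⇒≤ (toℕ<n i)))

  fewArcsAndNeighbours :
    (G : ℕ → Graph n) (H : Graph n) (k : Fin m) →
    evenᵇ (toℕ k) ≡ false →
    IsBipartiteGraph H →
    H x (u k) ≡ false →
    ∄[ i ] (arcD G (u i) (u k) ∧ H x (u (csuc i)) ≡ true) →
    indegD G (u k) + nbrsInC H x < n ∸ 1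
  fewArcsAndNeighbours G H k k-odd bipartite noDirect noDetour = begin-strict
    indegD G (u k) + nbrsInC H x
      ≡⟨ cong₂ _+_ (countV-∑ (λ v → arcD G v (u k)) refl refl)
                   (countV-∑ (λ v → H x v ∧ inC v) (∧-zeroʳ (H x x)) (∧-zeroʳ (H x y))) ⟩
    sum A + ∑[ j < m ] ⟦ H x (u j) ∧ true ⟧
      ≡⟨ cong (sum A +_) (sum-cong-≗ {m} (λ j → cong ⟦_⟧ (∧-identityʳ (H x (u j))))) ⟩
    sum A + sum B
      ≡⟨ cong (sum A +_) (∑-csuc B) ⟨
    sum A + sum (B ∘ csuc)
      <⟨ m<m+n (sum A + sum (B ∘ csuc)) k-counted ⟩
    sum A + sum (B ∘ csuc) + sum (E ∘ csuc)
      ≡⟨ cong (_+ sum (E ∘ csuc)) (∑-distrib-+ A (B ∘ csuc)) ⟨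
    sum (λ i → A i + B (csuc i)) + sum (E ∘ csuc)
      ≡⟨ ∑-distrib-+ (λ i → A i + B (csuc i)) (E ∘ csuc) ⟨
    ∑[ i < m ] (A i + B (csuc i) + E (csuc i))
      ≤⟨ ∑-mono-≤ pointwise ⟩
    sum (O ∘ csuc)
      ≡⟨ ∑-csuc O ⟩
    sum O
      ≡⟨ ∑-odd m≡[n∸1]+[n∸1] ⟩
    n ∸ 1 ∎
    where
    open ≤-Reasoning
    A B E O : Fin m → ℕ
    A i = ⟦ arcD G (u i) (u k) ⟧
    B j = ⟦ H x (u j) ⟧
    E j = ⟦ u {n} k == u j ⟧
    O j = ⟦ not (evenᵇ (toℕ j)) ⟧

    k-counted : 0 < sum (E ∘ csuc)
    k-counted = begin-strict
      0              <⟨ ≤-reflexive (cong ⟦_⟧ (sym (u-==-refl {n} k))) ⟩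
      E k            ≤⟨ term≤∑ E k ⟩
      sum E          ≡⟨ ∑-csuc E ⟨
      sum (E ∘ csuc) ∎

    pointwise : ∀ i → A i + B (csuc i) + E (csuc i) ≤ O (csuc i)
    pointwise i = ⟦⟧-exclusive-≤ (arcD G (u i) (u k)) (H x (u (csuc i))) (u {n} k == u (csuc i))
                                 (not (evenᵇ (toℕ (csuc i)))) arc⇒ adjacent⇒ k⇒
      where
      k≡next : (u {n} k == u (csuc i)) ≡ true → k ≡ csuc i
      k≡next = u-==⇒≡ {n}

      arc⇒ : arcD G (u i) (u k) ≡ true →
          H x (u (csuc i)) ≡ false × (u {n} k == u (csuc i)) ≡ false
        × not (evenᵇ (toℕ (csuc i))) ≡ true
      arc⇒ arc =
          ¬-not (λ adj → noDetour (i , cong₂ _∧_ arc adj))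
        , arcD-skips-next G i arc
        , trans (cong not (evenᵇ-csuc m-even i)) (trans (not-involutive _) (arcD-even G i arc))

      adjacent⇒ : H x (u (csuc i)) ≡ true →
        (u {n} k == u (csuc i)) ≡ false × not (evenᵇ (toℕ (csuc i))) ≡ true
      adjacent⇒ adj =
          ¬-not (λ k≡ → contradiction
                   (trans (sym adj) (trans (cong (H x ∘ u) (sym (k≡next k≡))) noDirect)) λ ())
        , sym (¬-not (proj₂ bipartite x (u (csuc i)) adj))

      k⇒ : (u {n} k == u (csuc i)) ≡ true → not (evenᵇ (toℕ (csuc i))) ≡ true
      k⇒ k≡ = trans (cong (λ (j : Fin m) → not (evenᵇ (toℕ j))) (sym (k≡next k≡)))
                    (cong not k-odd)

  module Path (G : ℕ → Graph n) (k : Fin m) (c : ℕ) (c≤M : c ≤ M) where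
    open RotationAfter k

    -- w 0, …, w M is the cycle read from u (csuc k) round to w M = u k.  The path is
    -- x, w (c+1), …, w M, w c, w (c-1), …, w 0, y, and its t-th edge borrows the colour of the
    -- cycle edge w j w (j+1) with j = edgeIndex t: the edge at x takes that of w M w 0 and the
    -- jump w M w c (present when c < M) that of w c w (c+1).

    w : ℕ → Vtx n
    w j = u (rotate j)

    colour : ℕ → ℕ
    colour j = suc (toℕ (rotate j))

    a : ℕ
    a = M ∸ c

    c+a≡M : c + a ≡ M
    c+a≡M = m+[n∸m]≡n c≤M

    M∸a≡c : M ∸ a ≡ c
    M∸a≡c = m∸[m∸n]≡n c≤M

    M∸t≤c : ∀ {t} → a ≤ t → M ∸ t ≤ c
    M∸t≤c a≤t = ≤-trans (∸-monoʳ-≤ M a≤t) (≤-reflexive M∸a≡c)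

    c+t<M : ∀ {t} → t < a → c + t < M
    c+t<M t<a = <-≤-trans (+-monoʳ-< c t<a) (≤-reflexive c+a≡M)

    visit : ℕ → ℕ
    visit t = if does (t <? a) then suc c + t else M ∸ t

    visit⁻¹ : ℕ → ℕ
    visit⁻¹ j = if does (c <? j) then j ∸ suc c else M ∸ j

    visit-< : ∀ {t} → t < a → visit t ≡ suc c + t
    visit-< {t} t<a rewrite dec-true (t <? a) t<a = refl

    visit-≥ : ∀ {t} → a ≤ t → visit t ≡ M ∸ t
    visit-≥ {t} a≤t rewrite dec-false (t <? a) (≤⇒≯ a≤t) = refl

    visit⁻¹-> : ∀ {j} → c < j → visit⁻¹ j ≡ j ∸ suc c
    visit⁻¹-> {j} c<j rewrite dec-true (c <? j) c<j = refl

    visit⁻¹-≤ : ∀ {j} → j ≤ c → visit⁻¹ j ≡ M ∸ j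
    visit⁻¹-≤ {j} j≤c rewrite dec-false (c <? j) (≤⇒≯ j≤c) = refl

    visit≤M : ∀ t → visit t ≤ M
    visit≤M t with t <? a
    ... | yes t<a rewrite visit-< t<a = c+t<M t<a
    ... | no t≮a rewrite visit-≥ (≮⇒≥ t≮a) = m∸n≤m M t

    visit⁻¹≤M : ∀ {j} → j ≤ M → visit⁻¹ j ≤ M
    visit⁻¹≤M {j} j≤M with c <? j
    ... | yes c<j rewrite visit⁻¹-> c<j = ≤-trans (m∸n≤m j (suc c)) j≤M
    ... | no c≮j rewrite visit⁻¹-≤ (≮⇒≥ c≮j) = m∸n≤m M j

    visit⁻¹-visit : ∀ {t} → t ≤ M → visit⁻¹ (visit t) ≡ t
    visit⁻¹-visit {t} t≤M with t <? a
    ... | yes t<a rewrite visit-< t<a | visit⁻¹-> (s≤s (m≤m+n c t)) = m+n∸m≡n (suc c) t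
    ... | no t≮a rewrite visit-≥ (≮⇒≥ t≮a) | visit⁻¹-≤ (M∸t≤c (≮⇒≥ t≮a)) =
      m∸[m∸n]≡n t≤M

    visit-visit⁻¹ : ∀ {j} → j ≤ M → visit (visit⁻¹ j) ≡ j
    visit-visit⁻¹ {j} j≤M with c <? j
    ... | yes c<j rewrite visit⁻¹-> c<j | visit-< (∸-monoˡ-< (s≤s j≤M) c<j) =
      m+[n∸m]≡n c<j
    ... | no c≮j rewrite visit⁻¹-≤ (≮⇒≥ c≮j) | visit-≥ (∸-monoʳ-≤ M (≮⇒≥ c≮j)) =
      m∸[m∸n]≡n j≤M

    path : ℕ → Vtx n
    path zero = x
    path (suc t) = if does (t <? m) then w (visit t) else y

    path-suc : ∀ {t} → t < m → path (suc t) ≡ w (visit t)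
    path-suc {t} t<m rewrite dec-true (t <? m) t<m = refl

    path-last : path (suc m) ≡ y
    path-last rewrite dec-false (m <? m) (<-irrefl refl) = refl

    index : Vtx n → ℕ
    index x = 0
    index (u i) = suc (visit⁻¹ (unrotate (toℕ i)))
    index y = suc m

    index< : ∀ v → index v < suc (suc m)
    index< x = s≤s z≤n
    index< (u i) =
      s≤s (s≤s (m≤n⇒m≤1+n (visit⁻¹≤M {unrotate (toℕ i)} (≤-pred (unrotate< (toℕ i))))))
    index< y = ≤-refl

    index-path : ∀ t → t < suc (suc m) → index (path t) ≡ t
    index-path zero _ = refl
    index-path (suc t) t<2+m with m≤n⇒m<n∨m≡n (≤-pred (≤-pred t<2+m))
    ... | inj₁ t<m rewrite path-suc t<m =
      cong suc (trans (cong visit⁻¹ (unrotate-rotate (s≤s (visit≤M t))))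
                      (visit⁻¹-visit (≤-pred t<m)))
    ... | inj₂ refl rewrite path-last = refl

    path-index : ∀ v → path (index v) ≡ v
    path-index x = refl
    path-index (u i) = begin
      path (suc (visit⁻¹ j))           ≡⟨ path-suc (s≤s (visit⁻¹≤M j≤M)) ⟩
      w (visit (visit⁻¹ j))            ≡⟨ cong w (visit-visit⁻¹ j≤M) ⟩
      u (rotate (unrotate (toℕ i)))    ≡⟨ cong u (rotate-unrotate i) ⟩
      u i ∎
      where
      open ≡-Reasoning
      j = unrotate (toℕ i)
      j≤M = ≤-pred (unrotate< (toℕ i))
    path-index y = path-last

    edgeIndex : ℕ → ℕ
    edgeIndex zero = M
    edgeIndex (suc t) = if does (suc t <? a) then suc c + t else M ∸ suc t

    edgeIndex⁻¹ : ℕ → ℕ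
    edgeIndex⁻¹ j = if does (j ≟ M) then 0 else if does (c <? j) then j ∸ c else M ∸ j

    edgeIndex-< : ∀ {t} → suc t < a → edgeIndex (suc t) ≡ suc c + t
    edgeIndex-< {t} st<a rewrite dec-true (suc t <? a) st<a = refl

    edgeIndex-≥ : ∀ {t} → a ≤ suc t → edgeIndex (suc t) ≡ M ∸ suc t
    edgeIndex-≥ {t} a≤st rewrite dec-false (suc t <? a) (≤⇒≯ a≤st) = refl

    edgeIndex≤M : ∀ t → edgeIndex t ≤ M
    edgeIndex≤M zero = ≤-refl
    edgeIndex≤M (suc t) with suc t <? a
    ... | yes st<a rewrite edgeIndex-< st<a = c+t<M (<-trans (n<1+n t) st<a)
    ... | no st≮a rewrite edgeIndex-≥ (≮⇒≥ st≮a) = m∸n≤m M (suc t)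

    edgeIndex⁻¹-edgeIndex : ∀ {t} → t ≤ M → edgeIndex⁻¹ (edgeIndex t) ≡ t
    edgeIndex⁻¹-edgeIndex {zero} _ rewrite dec-true (M ≟ M) refl = refl
    edgeIndex⁻¹-edgeIndex {suc t} st≤M with suc t <? a
    ... | yes st<a
      rewrite edgeIndex-< st<a
            | dec-false (suc c + t ≟ M)
                        (<⇒≢ (≤-trans (s≤s (≤-reflexive (sym (+-suc c t)))) (c+t<M st<a)))
            | dec-true (c <? suc c + t) (s≤s (m≤m+n c t))
            = trans (cong (_∸ c) (sym (+-suc c t))) (m+n∸m≡n c (suc t))
    ... | no st≮a
      rewrite edgeIndex-≥ (≮⇒≥ st≮a)
            | dec-false (M ∸ suc t ≟ M) (<⇒≢ (∸-monoʳ-< (s≤s z≤n) st≤M))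
            | dec-false (c <? M ∸ suc t) (≤⇒≯ (M∸t≤c (≮⇒≥ st≮a)))
            = m∸[m∸n]≡n st≤M

    colouring : ℕ → ℕ
    colouring t = if does (t <? m) then colour (edgeIndex t) else suc m

    colouring-< : ∀ {t} → t < m → colouring t ≡ colour (edgeIndex t)
    colouring-< {t} t<m rewrite dec-true (t <? m) t<m = refl

    colouring-last : colouring m ≡ suc m
    colouring-last rewrite dec-false (m <? m) (<-irrefl refl) = refl

    colouring⁻¹ : ℕ → ℕ
    colouring⁻¹ zero = m
    colouring⁻¹ (suc j) = if does (j <? m) then edgeIndex⁻¹ (unrotate j) else m

    colouring⁻¹-colouring : ∀ t → t < suc m → colouring⁻¹ (colouring t) ≡ t
    colouring⁻¹-colouring t t<1+m with m≤n⇒m<n∨m≡n (≤-pred t<1+m)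
    ... | inj₁ t<m
      rewrite colouring-< t<m
            | dec-true (toℕ (rotate (edgeIndex t)) <? m) (toℕ<n (rotate (edgeIndex t)))
      = trans (cong edgeIndex⁻¹ (unrotate-rotate (s≤s (edgeIndex≤M t))))
              (edgeIndex⁻¹-edgeIndex (≤-pred t<m))
    ... | inj₂ refl rewrite colouring-last | dec-false (m <? m) (<-irrefl refl) = refl

    colouring-range : ∀ t → t < suc m → 1 ≤ colouring t × colouring t ≤ suc m
    colouring-range t t<1+m with m≤n⇒m<n∨m≡n (≤-pred t<1+m)
    ... | inj₁ t<m rewrite colouring-< t<m = s≤s z≤n , s≤s (<⇒≤ (toℕ<n (rotate (edgeIndex t))))
    ... | inj₂ refl rewrite colouring-last = s≤s z≤n , ≤-refl

    module _ (symmetric : ∀ (i : Fin m) v v′ → G (suc (toℕ i)) v v′ ≡ G (suc (toℕ i)) v′ v)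
             (cycle : ∀ (i : Fin m) → G (suc (toℕ i)) (u i) (u (csuc i)) ≡ true)
             (fromX : G (colour M) x (w (visit 0)) ≡ true)
             (jump : c < M → G (colour c) (w M) (w c) ≡ true)
             (toY : G (suc m) (u (csuc k)) y ≡ true) where

      cycleEdge : ∀ j → G (colour j) (w j) (w (suc j)) ≡ true
      cycleEdge j = subst (λ i → G (colour j) (w j) (u i) ≡ true) (csuc-rotate j) (cycle (rotate j))

      cycleEdge⁻ : ∀ j → G (colour j) (w (suc j)) (w j) ≡ true
      cycleEdge⁻ j = trans (symmetric (rotate j) (w (suc j)) (w j)) (cycleEdge j)

      InnerEdge : ℕ → Set
      InnerEdge t = G (colour (edgeIndex (suc t))) (w (visit t)) (w (visit (suc t))) ≡ true

      forwardEdge : ∀ {t} → suc t < a → InnerEdge t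
      forwardEdge {t} st<a
        rewrite edgeIndex-< st<a | visit-< (<-trans (n<1+n t) st<a) | visit-< st<a | +-suc (suc c) t
        = cycleEdge (suc c + t)

      jumpEdge : ∀ {t} → suc t ≡ a → InnerEdge t
      jumpEdge {t} st≡a
        rewrite edgeIndex-≥ (≤-reflexive (sym st≡a)) | visit-< (≤-reflexive st≡a)
              | visit-≥ (≤-reflexive (sym st≡a))
        = subst₂ (λ i j → G (colour j) (w i) (w j) ≡ true) (sym 1+c+t≡M) (sym M∸st≡c)
                 (jump (subst (c <_) 1+c+t≡M (s≤s (m≤m+n c t))))
        where
        M∸st≡c : M ∸ suc t ≡ c
        M∸st≡c = trans (cong (M ∸_) st≡a) M∸a≡c
        1+c+t≡M : suc c + t ≡ M
        1+c+t≡M = trans (sym (+-suc c t)) (trans (cong (c +_) st≡a) c+a≡M)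

      backwardEdge : ∀ {t} → a < suc t → suc t ≤ M → InnerEdge t
      backwardEdge {t} a<st st≤M
        rewrite edgeIndex-≥ (<⇒≤ a<st) | visit-≥ (≤-pred a<st) | visit-≥ (<⇒≤ a<st)
              | +-∸-assoc 1 st≤M
        = cycleEdge⁻ (M ∸ suc t)

      innerEdge : ∀ t → suc t ≤ M → InnerEdge t
      innerEdge t st≤M with <-cmp (suc t) a
      ... | tri< st<a _ _ = forwardEdge st<a
      ... | tri≈ _ st≡a _ = jumpEdge st≡a
      ... | tri> _ _ a<st = backwardEdge a<st st≤M

      edge : ∀ t → t < suc m → G (colouring t) (path t) (path (suc t)) ≡ true
      edge zero _ rewrite colouring-< {0} (s≤s z≤n) | path-suc {0} (s≤s z≤n) = fromX
      edge (suc t) st<1+m with m≤n⇒m<n∨m≡n (≤-pred st<1+m)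
      ... | inj₁ st<m rewrite colouring-< st<m | path-suc st<m | path-suc (<-trans (n<1+n t) st<m) =
        innerEdge t (≤-pred st<m)
      ... | inj₂ refl rewrite colouring-last | path-suc {M} ≤-refl | path-last
                            | visit-≥ (m∸n≤m M c) | n∸n≡0 M | rotate-zero = toY

      transversalPath : TransversalHamiltonPath n G
      transversalPath =
          path , colouring , refl , path-last
        , retraction⇒injectiveBelow index index-path
        , (λ v → index v , index< v , path-index v)
        , retraction⇒injectiveBelow colouring⁻¹ colouring⁻¹-colouring
        , colouring-range , edge

  module _ (G : ℕ → Graph n)
           (bipartite : ∀ j → 1 ≤ j → j ≤ 2 * n ∸ 1 → IsBipartiteGraph (G j))
           (cycle : ∀ (i : Fin m) → G (suc (toℕ i)) (u i) (u (csuc i)) ≡ true)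
           (k : Fin m) (toY : G (suc m) (u (csuc k)) y ≡ true) where
    open RotationAfter k

    private
      symmetric : ∀ (i : Fin m) v v′ → G (suc (toℕ i)) v v′ ≡ G (suc (toℕ i)) v′ v
      symmetric = proj₁ ∘ cycleColourBipartite bipartite

    pathViaDirectEdge : G (suc (toℕ k)) x (u k) ≡ true → TransversalHamiltonPath n G
    pathViaDirectEdge direct = transversalPath symmetric cycle fromX noJump toY
      where
      open Path G k M ≤-refl
      fromX : G (colour M) x (w (visit 0)) ≡ true
      fromX rewrite visit-≥ {0} (≤-reflexive (n∸n≡0 M)) | rotate-last = direct
      noJump : M < M → G (colour M) (w M) (w M) ≡ true
      noJump M<M = contradiction M<M (<-irrefl refl)

    pathViaDetour : (i : Fin m) → i ≢ k →
      G (suc (toℕ i)) (u i) (u k) ≡ true → G (suc (toℕ k)) x (u (csuc i)) ≡ true →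
      TransversalHamiltonPath n G
    pathViaDetour i i≢k back forth = transversalPath symmetric cycle fromX jump toY
      where
      c : ℕ
      c = unrotate (toℕ i)
      c≤M : c ≤ M
      c≤M = ≤-pred (unrotate< (toℕ i))
      c<M : c < M
      c<M = ≤∧≢⇒< c≤M λ c≡M →
        i≢k (trans (sym (rotate-unrotate i)) (trans (cong rotate c≡M) rotate-last))
      open Path G k c c≤M
      fromX : G (colour M) x (w (visit 0)) ≡ true
      fromX rewrite visit-< {0} (m<n⇒0<n∸m c<M) | +-identityʳ c | sym (csuc-rotate c)
                  | rotate-unrotate i | rotate-last = forth
      jump : c < M → G (colour c) (w M) (w c) ≡ true
      jump _ rewrite rotate-unrotate i | rotate-last = trans (symmetric i (u k) (u i)) back

lemma2p2 :
    (n : ℕ) → 3 ≤ n →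
    (G : ℕ → Graph n) →
    (∀ j → 1 ≤ j → j ≤ 2 * n ∸ 1 → IsBipartiteGraph (G j)) →
    (∀ (i : Fin (L n)) → G (suc (toℕ i)) (u i) (u (csuc i)) ≡ true) →
    (Σ (Fin (L n)) λ k →
        (evenᵇ (toℕ k) ≡ false)
      × (n ∸ 1 ≤ indegD G (u k) + nbrsInC (G (suc (toℕ k))) x)
      × (G (2 * n ∸ 1) (u (csuc k)) y ≡ true)) →
    Σ (ℕ → Vtx n) λ p → Σ (ℕ → ℕ) λ φ →
        (p 0 ≡ x)
      × (p (2 * n ∸ 1) ≡ y)
      × (∀ s t → s < 2 * n → t < 2 * n → p s ≡ p t → s ≡ t)
      × (∀ v → ∃ λ t → t < 2 * n × p t ≡ v)
      × (∀ s t → s < 2 * n ∸ 1 → t < 2 * n ∸ 1 → φ s ≡ φ t → s ≡ t)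
      × (∀ t → t < 2 * n ∸ 1 → 1 ≤ φ t × φ t ≤ 2 * n ∸ 1)
      × (∀ t → t < 2 * n ∸ 1 → G (φ t) (p t) (p (suc t)) ≡ true)
lemma2p2 (suc (suc (suc n₀))) _ G bipartite cycle (k , k-odd , manyArcsAndNeighbours , toY)
  with G (suc (toℕ k)) x (u k) in direct
... | true = pathViaDirectEdge n₀ G bipartite cycle k toY direct
... | false with any? (λ i → arcD G (u i) (u k) ∧ G (suc (toℕ k)) x (u (csuc i)) Bool.≟ true)
...   | yes (i , detour) = pathViaDetour n₀ G bipartite cycle k toY i i≢k (arcD-edge G i arc) forth
  where
  arc : arcD G (u i) (u k) ≡ true
  arc = ∧-conicalˡ (arcD G (u i) (u k)) (G (suc (toℕ k)) x (u (csuc i))) detour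
  forth : G (suc (toℕ k)) x (u (csuc i)) ≡ true
  forth = ∧-conicalʳ (arcD G (u i) (u k)) (G (suc (toℕ k)) x (u (csuc i))) detour
  i≢k : i ≢ k
  i≢k i≡k =
    contradiction (trans (sym (arcD-even G i arc)) (trans (cong (evenᵇ ∘ toℕ) i≡k) k-odd)) λ ()
...   | no noDetour =
  contradiction manyArcsAndNeighbours
    (<⇒≱ (fewArcsAndNeighbours n₀ G (G (suc (toℕ k))) k k-odd
            (cycleColourBipartite n₀ bipartite k) direct noDetour))
lemma2p2 0 ()
lemma2p2 1 (s≤s ())
lemma2p2 2 (s≤s (s≤s ()))
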